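{- Let $a$ and $b$ be even integers with $12 \le 3a \le b$, and let $t$ be an integer with $t \ge \frac{(a+b)^2 - 3a - 4b}{2b}$. Let $H_1$ and $H_2$ be complete graphs on $t$ vertices with $V(H_i) = \{x_{i1}, \ldots, x_{it}\}$ for $i \in \{1,2\}$, and let $H_3$ be the complete graph on two vertices $y, z$. Let $H$ be the graph obtained from the disjoint union of $H_1, H_2, H_3$ by adding the edges joining $y$ to each of $x_{11}, \ldots, x_{1(\frac a2 - 1)}, x_{2\frac a2}, \ldots, x_{2(a-1)}$, and the edges joining $z$ to each of $x_{21}, \ldots, x_{2(\frac a2 - 1)}, x_{1\frac a2}, \ldots, x_{1(a-1)}$. Then $H$ has edge-connectivity exactly $a-1$ (in particular $\kappa'(H) \ge 2$), $|V(H)| \ge 2a + b + \frac{a^2-3a}{b} - 2$, $\delta(H) \ge a$, and $\sigma_2(H) \ge \frac{2a|V(H)|}{a+b}$; moreover, $H$ does not contain an even $[a,b]$-factor.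
   Context: All graphs are finite and simple. An even $[a,b]$-factor of a graph $G$ is a spanning subgraph $F$ such that for every vertex $v$, $d_F(v)$ is even and $a \le d_F(v) \le b$. $\kappa'(G)$ is the edge-connectivity of $G$ (the largest $k$ such that $G - S$ is connected for every edge set $S$ with $|S| < k$). $\delta(G)$ is the minimum degree, and $\sigma_2(G) = \min_{uv \notin E(G),\, u \ne v} (d(u) + d(v))$. -}

module Defs where

open import Data.Nat using (ℕ; zero; suc; _+_; _*_; _∸_; _≤_; _<_; _/_; _≡ᵇ_; _<ᵇ_)
open import Data.Nat.Divisibility using (_∣_)
open import Data.Fin using (Fin; toℕ)
open import Data.Bool using (Bool; true; false; _∧_; _∨_; not; if_then_else_)
open import Data.List using (List; map; allFin)
open import Data.Nat.ListAction using (sum)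
open import Data.Product using (Σ; _×_)
open import Relation.Binary.PropositionalEquality using (_≡_)

Even : ℕ → Set
Even m = 2 ∣ m

Rel : ℕ → Set
Rel n = Fin n → Fin n → Bool

count : (n : ℕ) → (Fin n → Bool) → ℕ
count n f = sum (map (λ i → if f i then 1 else 0) (allFin n))

deg : {n : ℕ} → Rel n → Fin n → ℕ
deg {n} adj v = count n (adj v)

Symmetric : {n : ℕ} → Rel n → Set
Symmetric {n} R = (u v : Fin n) → R u v ≡ R v u

_⊆E_ : {n : ℕ} → Rel n → Rel n → Set
_⊆E_ {n} S G = (u v : Fin n) → S u v ≡ true → G u v ≡ true

edgeCount : {n : ℕ} → Rel n → ℕ
edgeCount {n} S = sum (map (λ i → count n (λ j → (toℕ i <ᵇ toℕ j) ∧ S i j)) (allFin n))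

removeEdges : {n : ℕ} → Rel n → Rel n → Rel n
removeEdges G S u v = G u v ∧ not (S u v)

data Reach {n : ℕ} (G : Rel n) : Fin n → Fin n → Set where
  here : {u : Fin n} → Reach G u u
  step : {u w v : Fin n} → G u w ≡ true → Reach G w v → Reach G u v

Connected : {n : ℕ} → Rel n → Set
Connected {n} G = (u v : Fin n) → Reach G u v

KEdgeConnected : {n : ℕ} → Rel n → ℕ → Set
KEdgeConnected {n} G k =
  (S : Rel n) → Symmetric S → S ⊆E G → edgeCount S < k → Connected (removeEdges G S)

HasEvenFactor : {n : ℕ} → Rel n → ℕ → ℕ → Set
HasEvenFactor {n} G a b =
  Σ (Rel n) λ F → Symmetric F × F ⊆E G ×
    ((v : Fin n) → Even (deg F v) × a ≤ deg F v × deg F v ≤ b)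

MinDegGE : {n : ℕ} → Rel n → ℕ → Set
MinDegGE {n} G a = (v : Fin n) → a ≤ deg G v

-- The graph H of the statement.
-- Vertex labels: X i j  is x_{ij} (i ∈ {1,2}, 1 ≤ j ≤ t), Y is y, Z is z.

data Lab : Set where
  X : ℕ → ℕ → Lab
  Y : Lab
  Z : Lab

-- vertices of H are Fin (t + t + 2):
-- k < t ↦ x_{1,k+1};  t ≤ k < 2t ↦ x_{2,k-t+1};  2t ↦ y;  2t+1 ↦ z
label : (t : ℕ) → Fin (t + t + 2) → Lab
label t k =
  if toℕ k <ᵇ t then X 1 (suc (toℕ k))
  else if toℕ k <ᵇ t + t then X 2 (suc (toℕ k ∸ t))
  else if toℕ k ≡ᵇ t + t then Y
  else Z

-- lo ≤ j ≤ hi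
inRange : ℕ → ℕ → ℕ → Bool
inRange lo hi j = (lo ∸ 1 <ᵇ j) ∧ (j <ᵇ suc hi)

yNbr : ℕ → ℕ → ℕ → Bool
yNbr a i j = ((i ≡ᵇ 1) ∧ inRange 1 (a / 2 ∸ 1) j) ∨ ((i ≡ᵇ 2) ∧ inRange (a / 2) (a ∸ 1) j)

zNbr : ℕ → ℕ → ℕ → Bool
zNbr a i j = ((i ≡ᵇ 2) ∧ inRange 1 (a / 2 ∸ 1) j) ∨ ((i ≡ᵇ 1) ∧ inRange (a / 2) (a ∸ 1) j)

labAdj : ℕ → Lab → Lab → Bool
labAdj a (X i j) (X i' j') = (i ≡ᵇ i') ∧ not (j ≡ᵇ j')
labAdj a (X i j) Y = yNbr a i j
labAdj a (X i j) Z = zNbr a i j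
labAdj a Y (X i j) = yNbr a i j
labAdj a Y Y = false
labAdj a Y Z = true
labAdj a Z (X i j) = zNbr a i j
labAdj a Z Y = true
labAdj a Z Z = false

H : (a t : ℕ) → Rel (t + t + 2)
H a t u v = labAdj a (label t u) (label t v)

module Submission where

-- Vertices are handled as natural
-- numbers below N = t + t + 2 (A = [0,t), B = [t,2t), y = 2t, z = 2t + 1) and
-- degrees and edge numbers as counts #{k < n | g k}.
--
-- Counting develops finite sums and counts over {0..n-1}; FinBridge moves the
-- Fin-indexed notions of the statement to ℕ; EdgeBounds bounds degrees by the
-- number of edges; Graph gives the adjacency table of H; Arith collects the
-- arithmetic, in particular that the hypothesis on t forces 2a ≤ t + 3.
-- Construction then derives, with a = 2m, m ≥ 2, a < t:
-- * degrees: y and z have degree a, the other vertices degree ≥ t - 1 ≥ a;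
-- * no even [a,b]-factor F: F keeps all edges at y and z, so the F-degree sum
--   over A is 2·e_F(A) + (m - 1) + m, odd, while every F-degree is even;
-- * the a - 1 edges between A and {y, z} disconnect H;
-- * deleting E ≤ a - 2 edges leaves H connected: as t > 2E each clique stays
--   connected, y and z keep a neighbour outside {y, z}, and since at most 2m - 2
--   of the 2a - 1 edges at y and z are deleted, some A–B walk through y, z survives.

open import Defs
open import Data.Nat
open import Data.Nat.Properties
open import Data.Nat.DivMod using (m*n/n≡m)
open import Data.Nat.Divisibility using (_∣_; divides; ∣m∣n⇒∣m+n; ∣m+n∣m⇒∣n; ∣1⇒≡1)
open import Data.Nat.ListAction using (sum)
open import Data.Nat.Tactic.RingSolver using (solve-∀)
open import Data.Bool using (Bool; true; false; _∧_; _∨_; _xor_; not; if_then_else_; T)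
open import Data.Bool.Properties using (∨-identityʳ; xor-comm; ∧-conicalˡ; ∧-conicalʳ; ∧-zeroʳ)
open import Data.Product using (Σ; _×_; _,_; proj₁; proj₂)
open import Data.Sum using (_⊎_; inj₁; inj₂)
open import Data.Empty using (⊥; ⊥-elim)
open import Data.Unit using (tt)
open import Relation.Nullary using (¬_; yes; no)
open import Relation.Binary.PropositionalEquality
open import Data.Fin using (Fin; toℕ; fromℕ<) renaming (zero to fz; suc to fs)
open import Data.Fin.Properties using (toℕ-fromℕ<; fromℕ<-toℕ; toℕ<n; toℕ-injective)
open import Data.List using (map; allFin)
open import Data.List.Properties using (map-tabulate)
open import Function using (_∘_; id)
open import Algebra.Properties.CommutativeSemigroup +-commutativeSemigroup using (interchange)

module Counting where

  ind : Bool → ℕ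
  ind true = 1
  ind false = 0

  sumTo : ℕ → (ℕ → ℕ) → ℕ
  sumTo zero h = 0
  sumTo (suc n) h = sumTo n h + h n

  countTo : ℕ → (ℕ → Bool) → ℕ
  countTo n g = sumTo n (λ k → ind (g k))

  sumTo-cong : ∀ n {h h' : ℕ → ℕ} → (∀ k → k < n → h k ≡ h' k) → sumTo n h ≡ sumTo n h'
  sumTo-cong zero e = refl
  sumTo-cong (suc n) e = cong₂ _+_ (sumTo-cong n (λ k k<n → e k (m<n⇒m<1+n k<n))) (e n ≤-refl)

  sumTo-mono : ∀ n {h h' : ℕ → ℕ} → (∀ k → k < n → h k ≤ h' k) → sumTo n h ≤ sumTo n h'
  sumTo-mono zero e = z≤n
  sumTo-mono (suc n) e = +-mono-≤ (sumTo-mono n (λ k k<n → e k (m<n⇒m<1+n k<n))) (e n ≤-refl)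

  sumTo-+ : ∀ n (h h' : ℕ → ℕ) → sumTo n (λ k → h k + h' k) ≡ sumTo n h + sumTo n h'
  sumTo-+ zero h h' = refl
  sumTo-+ (suc n) h h' rewrite sumTo-+ n h h' = interchange (sumTo n h) (sumTo n h') (h n) (h' n)

  sumTo-split : ∀ m n (h : ℕ → ℕ) → sumTo (m + n) h ≡ sumTo m h + sumTo n (λ k → h (m + k))
  sumTo-split m zero h rewrite +-identityʳ m = sym (+-identityʳ (sumTo m h))
  sumTo-split m (suc n) h rewrite +-suc m n | sumTo-split m n h =
    +-assoc (sumTo m h) (sumTo n (λ k → h (m + k))) (h (m + n))

  sumTo-at : ∀ n u (h : ℕ → ℕ) → u < n →
    sumTo n h ≡ sumTo u h + h u + sumTo (n ∸ suc u) (λ j → h (suc u + j))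
  sumTo-at n u h p =
    trans (cong (λ x → sumTo x h) (sym (m+[n∸m]≡n p))) (sumTo-split (suc u) (n ∸ suc u) h)

  sumTo-zero : ∀ n (h : ℕ → ℕ) → (∀ k → k < n → h k ≡ 0) → sumTo n h ≡ 0
  sumTo-zero zero h e = refl
  sumTo-zero (suc n) h e =
    cong₂ _+_ (sumTo-zero n h (λ k p → e k (m<n⇒m<1+n p))) (e n ≤-refl)

  sumTo-monoˡ : ∀ m n h → m ≤ n → sumTo m h ≤ sumTo n h
  sumTo-monoˡ m n h m≤n =
    subst (λ x → sumTo m h ≤ sumTo x h) (m+[n∸m]≡n m≤n)
      (subst (sumTo m h ≤_) (sym (sumTo-split m (n ∸ m) h)) (m≤m+n _ _))

  term≤sumTo : ∀ n (h : ℕ → ℕ) k → k < n → h k ≤ sumTo n h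
  term≤sumTo n h k p rewrite sumTo-at n k h p =
    ≤-trans (m≤n+m (h k) (sumTo k h)) (m≤m+n _ _)

  two-terms≤sumTo : ∀ n (h : ℕ → ℕ) j1 j2 → j1 < j2 → j2 < n → h j1 + h j2 ≤ sumTo n h
  two-terms≤sumTo n h j1 j2 p q rewrite sumTo-at n j2 h q =
    ≤-trans (+-monoˡ-≤ (h j2) (term≤sumTo j2 h j1 p)) (m≤m+n _ _)

  countTo-all : ∀ n → sumTo n (λ _ → 1) ≡ n
  countTo-all zero = refl
  countTo-all (suc n) rewrite countTo-all n = +-comm n 1

  countTo-witness : ∀ n g → 0 < countTo n g → Σ ℕ λ k → k < n × g k ≡ true
  countTo-witness (suc n) g p with g n in eq
  ... | true = n , ≤-refl , eq
  ... | false with countTo-witness n g (subst (0 <_) (+-identityʳ (countTo n g)) p)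
  ...   | k , k<n , gk = k , m<n⇒m<1+n k<n , gk

  countTo-atMostOne : ∀ n (g : ℕ → Bool) k → (∀ w → w < n → g w ≡ true → w ≡ k) → countTo n g ≤ 1
  countTo-atMostOne zero g k e = z≤n
  countTo-atMostOne (suc n) g k e with g n in eq
  ... | false = subst (_≤ 1) (sym (+-identityʳ (countTo n g)))
                  (countTo-atMostOne n g k (λ w p → e w (m<n⇒m<1+n p)))
  ... | true = subst (_≤ 1) (sym (cong (_+ 1) noneBelow)) ≤-refl
    where
    noneBelow : countTo n g ≡ 0
    noneBelow = sumTo-zero n _ absent
      where absent : ∀ w → w < n → ind (g w) ≡ 0
            absent w p with g w in gw
            ... | false = refl
            ... | true = ⊥-elim (<-irrefl (trans (e w (m<n⇒m<1+n p) gw) (sym (e n ≤-refl eq))) p)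

  T→≡ : ∀ {b} → T b → b ≡ true
  T→≡ {true} _ = refl

  ≡→T : ∀ {b} → b ≡ true → T b
  ≡→T refl = tt

  <ᵇ-true : ∀ {m n} → m < n → (m <ᵇ n) ≡ true
  <ᵇ-true p = T→≡ (<⇒<ᵇ p)

  <ᵇ-false : ∀ {m n} → ¬ m < n → (m <ᵇ n) ≡ false
  <ᵇ-false {m} {n} p with m <ᵇ n in eq
  ... | false = refl
  ... | true = ⊥-elim (p (<ᵇ⇒< m n (≡→T eq)))

  ≡ᵇ-refl : ∀ m → (m ≡ᵇ m) ≡ true
  ≡ᵇ-refl m = T→≡ (≡⇒≡ᵇ m m refl)

  ≡ᵇ-false : ∀ {m n} → ¬ m ≡ n → (m ≡ᵇ n) ≡ false
  ≡ᵇ-false {m} {n} p with m ≡ᵇ n in eq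
  ... | false = refl
  ... | true = ⊥-elim (p (≡ᵇ⇒≡ m n (≡→T eq)))

  ≡ᵇ-sound : ∀ {m n} → (m ≡ᵇ n) ≡ true → m ≡ n
  ≡ᵇ-sound {m} {n} e = ≡ᵇ⇒≡ m n (≡→T e)

  countTo-<ᵇ : ∀ n h → countTo n (λ k → k <ᵇ h) ≡ n ⊓ h
  countTo-<ᵇ zero h = refl
  countTo-<ᵇ (suc n) h rewrite countTo-<ᵇ n h with n <? h
  ... | yes p rewrite <ᵇ-true p | m≤n⇒m⊓n≡m (<⇒≤ p) | m≤n⇒m⊓n≡m p = +-comm n 1
  ... | no p rewrite <ᵇ-false p | m≥n⇒m⊓n≡n (≮⇒≥ p) | m≥n⇒m⊓n≡n (≤-trans (≮⇒≥ p) (n≤1+n n)) =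
    +-identityʳ h

  -- #{k < n | lo ≤ k < hi} = hi - lo, stated additively
  countTo-range : ∀ n lo hi → lo ≤ hi → hi ≤ n →
    countTo n (λ k → (lo <ᵇ suc k) ∧ (k <ᵇ hi)) + lo ≡ hi
  countTo-range n lo hi lo≤hi hi≤n =
    trans (cong₂ _+_ refl (sym (trans (countTo-<ᵇ n lo) (m≥n⇒m⊓n≡n (≤-trans lo≤hi hi≤n)))))
    (trans (sym (sumTo-+ n _ _)) (trans (sumTo-cong n pt) (trans (countTo-<ᵇ n hi) (m≥n⇒m⊓n≡n hi≤n))))
    where
    pt : ∀ k → k < n → ind ((lo <ᵇ suc k) ∧ (k <ᵇ hi)) + ind (k <ᵇ lo) ≡ ind (k <ᵇ hi)
    pt k _ with k <? lo
    ... | yes p rewrite <ᵇ-false {lo} {suc k} (λ q → <⇒≱ p (s≤s⁻¹ q))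
                      | <ᵇ-true (<-≤-trans p lo≤hi) | <ᵇ-true p = refl
    ... | no p rewrite <ᵇ-true {lo} {suc k} (s≤s (≮⇒≥ p)) | <ᵇ-false p with k <ᵇ hi
    ...   | true = refl
    ...   | false = refl

  countTo-allBut : ∀ n (g : ℕ → Bool) k → (∀ w → w < n → g w ≡ not (k ≡ᵇ w)) → n ≤ suc (countTo n g)
  countTo-allBut n g k e =
    ≤-trans (≤-reflexive (sym (countTo-all n)))
    (≤-trans (sumTo-mono n pt)
    (≤-trans (≤-reflexive (sumTo-+ n _ _))
    (≤-trans (+-monoʳ-≤ (countTo n g) (countTo-atMostOne n (λ w → w ≡ᵇ k) k (λ w _ q → ≡ᵇ-sound q)))
     (≤-reflexive (+-comm (countTo n g) 1)))))
    where
    pt : ∀ w → w < n → 1 ≤ ind (g w) + ind (w ≡ᵇ k)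
    pt w p rewrite e w p with w ≟ k
    ... | yes refl rewrite ≡ᵇ-refl w = ≤-refl
    ... | no ne rewrite ≡ᵇ-false {k} {w} (λ q → ne (sym q)) = s≤s z≤n

  countTo-∧not : ∀ n (g h : ℕ → Bool) → countTo n g ≤ countTo n (λ k → g k ∧ not (h k)) + countTo n h
  countTo-∧not n g h = ≤-trans (sumTo-mono n (λ k _ → pt (g k) (h k))) (≤-reflexive (sumTo-+ n _ _))
    where pt : ∀ x y → ind x ≤ ind (x ∧ not y) + ind y
          pt true true = s≤s z≤n
          pt true false = ≤-refl
          pt false y = z≤n

  countTo-∩ : ∀ n (g h : ℕ → Bool) → countTo n g + countTo n h ≤ n + countTo n (λ k → g k ∧ h k)
  countTo-∩ n g h = begin
    countTo n g + countTo n h              ≡⟨ sym (sumTo-+ n _ _) ⟩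
    sumTo n (λ k → ind (g k) + ind (h k))  ≤⟨ sumTo-mono n (λ k _ → pt (g k) (h k)) ⟩
    sumTo n (λ k → 1 + ind (g k ∧ h k))    ≡⟨ sumTo-+ n _ _ ⟩
    sumTo n (λ _ → 1) + countTo n gh       ≡⟨ cong (_+ countTo n gh) (countTo-all n) ⟩
    n + countTo n gh                       ∎
    where
    open ≤-Reasoning
    gh : ℕ → Bool
    gh k = g k ∧ h k
    pt : ∀ x y → ind x + ind y ≤ 1 + ind (x ∧ y)
    pt true true = ≤-refl
    pt true false = ≤-refl
    pt false true = ≤-refl
    pt false false = z≤n

  countTo-squeeze : ∀ n (g h : ℕ → Bool) → (∀ l → l < n → g l ≡ true → h l ≡ true) →
    countTo n h ≤ countTo n g → ∀ l → l < n → g l ≡ h l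
  countTo-squeeze n g h gh le l p with g l in gl | h l in hl
  ... | true | true = refl
  ... | false | false = refl
  ... | true | false = trans (sym (gh l p gl)) hl
  ... | false | true = ⊥-elim (<-irrefl refl (≤-trans bigger le))
    where
    pt : ∀ j → j < n → ind (g j) + ind (j ≡ᵇ l) ≤ ind (h j)
    pt j q with j ≟ l
    ... | yes refl rewrite gl | hl | ≡ᵇ-refl j = ≤-refl
    ... | no ne rewrite ≡ᵇ-false ne | +-identityʳ (ind (g j)) with g j in gj
    ...   | false = z≤n
    ...   | true rewrite gh j q gj = ≤-refl
    one≤ : 1 ≤ countTo n (λ j → j ≡ᵇ l)
    one≤ = subst (_≤ countTo n (λ j → j ≡ᵇ l)) (cong ind (≡ᵇ-refl l)) (term≤sumTo n _ l p)
    bigger : suc (countTo n g) ≤ countTo n h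
    bigger = ≤-trans (subst (_≤ countTo n g + countTo n (λ j → j ≡ᵇ l)) (+-comm (countTo n g) 1)
                        (+-monoʳ-≤ (countTo n g) one≤))
               (subst (_≤ countTo n h) (sumTo-+ n _ _) (sumTo-mono n pt))

  sumTo-even : ∀ n (h : ℕ → ℕ) → (∀ k → k < n → 2 ∣ h k) → 2 ∣ sumTo n h
  sumTo-even zero h e = divides 0 refl
  sumTo-even (suc n) h e = ∣m∣n⇒∣m+n (sumTo-even n h (λ k p → e k (m<n⇒m<1+n p))) (e n ≤-refl)

  odd-not-even : ∀ c → ¬ 2 ∣ (c + c + 1)
  odd-not-even c p with ∣1⇒≡1 (∣m+n∣m⇒∣n p (divides c (c+c≡c*2 c)))
    where c+c≡c*2 : ∀ c → c + c ≡ c * 2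
          c+c≡c*2 = solve-∀
  ... | ()

  handshake : ∀ n (f : ℕ → ℕ → Bool) → (∀ k l → f k l ≡ f l k) → (∀ k → k < n → f k k ≡ false) →
    Σ ℕ λ q → sumTo n (λ k → countTo n (f k)) ≡ q + q
  handshake zero f fsy fi = 0 , refl
  handshake (suc n) f fsy fi with handshake n f fsy (λ k p → fi k (m<n⇒m<1+n p))
  ... | q , e = q + c , eqn
    where
    c = countTo n (f n)
    column : sumTo n (λ k → ind (f k n)) ≡ c
    column = sumTo-cong n (λ k _ → cong ind (fsy k n))
    eqn : sumTo (suc n) (λ k → countTo (suc n) (f k)) ≡ (q + c) + (q + c)
    eqn rewrite sumTo-+ (suc n) (λ k → countTo n (f k)) (λ k → ind (f k n))
              | e | column | fi n ≤-refl | +-identityʳ c = shuffle q c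
      where shuffle : ∀ q c → q + q + c + c ≡ q + c + (q + c)
            shuffle = solve-∀

module FinBridge where
  open Counting

  sumTo-front : ∀ n (h : ℕ → ℕ) → sumTo (suc n) h ≡ h 0 + sumTo n (λ k → h (suc k))
  sumTo-front n h = sumTo-split 1 n h

  sum-allFin : ∀ n (h : Fin n → ℕ) (h' : ℕ → ℕ) → (∀ i → h i ≡ h' (toℕ i)) →
    sum (map h (allFin n)) ≡ sumTo n h'
  sum-allFin zero h h' e = refl
  sum-allFin (suc n) h h' e =
    trans (cong (λ l → h fz + sum l) (map-tabulate fs h))
    (trans (cong (h fz +_) (trans (cong sum (sym (map-tabulate id (h ∘ fs))))
                                  (sum-allFin n (h ∘ fs) (h' ∘ suc) (λ i → e (fs i)))))
    (trans (cong (_+ sumTo n (h' ∘ suc)) (e fz)) (sym (sumTo-front n h'))))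

  count≡countTo : ∀ n (f : Fin n → Bool) (g : ℕ → Bool) → (∀ i → f i ≡ g (toℕ i)) →
    count n f ≡ countTo n g
  count≡countTo n f g e = sum-allFin n _ _ (λ i → trans (if≡ind (f i)) (cong ind (e i)))
    where if≡ind : ∀ b → (if b then 1 else 0) ≡ ind b
          if≡ind true = refl
          if≡ind false = refl

  toFin : ∀ {n} → Fin n → ℕ → Fin n
  toFin {n} d k with k <? n
  ... | yes p = fromℕ< p
  ... | no _ = d

  toℕ-toFin : ∀ {n} (d : Fin n) k → k < n → toℕ (toFin d k) ≡ k
  toℕ-toFin {n} d k p with k <? n
  ... | yes q = toℕ-fromℕ< q
  ... | no q = ⊥-elim (q p)

  toFin-toℕ : ∀ {n} (d : Fin n) (i : Fin n) → toFin d (toℕ i) ≡ i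
  toFin-toℕ {n} d i with toℕ i <? n
  ... | yes q = fromℕ<-toℕ i q
  ... | no q = ⊥-elim (q (toℕ<n i))

  lower : ∀ {n} → Fin n → Rel n → ℕ → ℕ → Bool
  lower d R k l = R (toFin d k) (toFin d l)

  lower-sym : ∀ {n} (d : Fin n) R → Symmetric R → ∀ k l → lower d R k l ≡ lower d R l k
  lower-sym d R s k l = s (toFin d k) (toFin d l)

  lower-toℕ : ∀ {n} (d : Fin n) R (u v : Fin n) → lower d R (toℕ u) (toℕ v) ≡ R u v
  lower-toℕ d R u v rewrite toFin-toℕ d u | toFin-toℕ d v = refl

  deg≡countTo : ∀ {n} (d : Fin n) R (v : Fin n) → deg R v ≡ countTo n (lower d R (toℕ v))
  deg≡countTo {n} d R v = count≡countTo n (R v) _ (λ i → sym (lower-toℕ d R v i))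

  deg-at : ∀ {n} (d : Fin n) R k → k < n → deg R (toFin d k) ≡ countTo n (lower d R k)
  deg-at {n} d R k p =
    trans (deg≡countTo d R (toFin d k)) (cong (λ x → countTo n (lower d R x)) (toℕ-toFin d k p))

  edgesℕ : ℕ → (ℕ → ℕ → Bool) → ℕ
  edgesℕ n s = sumTo n (λ i → countTo n (λ j → (i <ᵇ j) ∧ s i j))

  edgeCount≡edgesℕ : ∀ {n} (d : Fin n) S → edgeCount S ≡ edgesℕ n (lower d S)
  edgeCount≡edgesℕ {n} d S = sum-allFin n _ _ (λ i → count≡countTo n _ _
    (λ j → cong ((toℕ i <ᵇ toℕ j) ∧_) (sym (lower-toℕ d S i j))))

  Reach-trans : ∀ {n} {G : Rel n} {u v w} → Reach G u v → Reach G v w → Reach G u w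
  Reach-trans here q = q
  Reach-trans (step e p) q = step e (Reach-trans p q)

  Reach-sym : ∀ {n} {G : Rel n} → Symmetric G → ∀ {u v} → Reach G u v → Reach G v u
  Reach-sym s here = here
  Reach-sym s (step {u} {w} e p) = Reach-trans (Reach-sym s p) (step (trans (s w u) e) here)

module EdgeBounds where
  open Counting
  open FinBridge using (edgesℕ)

  rowAbove : ℕ → (ℕ → ℕ → Bool) → ℕ → ℕ
  rowAbove n s i = countTo n (λ j → (i <ᵇ j) ∧ s i j)

  below≤rowAbove : ∀ n (s : ℕ → ℕ → Bool) u i → (∀ k l → s k l ≡ s l k) → u < n → i < u →
    ind (s u i) ≤ rowAbove n s i
  below≤rowAbove n s u i sy p i<u =
    subst (_≤ rowAbove n s i) (cong ind (trans (cong (_∧ s i u) (<ᵇ-true i<u)) (sy i u)))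
      (term≤sumTo n (λ j → ind ((i <ᵇ j) ∧ s i j)) u p)

  degree≤edges : ∀ n (s : ℕ → ℕ → Bool) u → (∀ k l → s k l ≡ s l k) → s u u ≡ false → u < n →
    countTo n (s u) ≤ edgesℕ n s
  degree≤edges n s u sy su p =
    subst (_≤ edgesℕ n s) (sym split) (≤-trans (+-mono-≤ before after) rows)
    where
    r = n ∸ suc u
    split : countTo n (s u) ≡ countTo u (s u) + countTo r (λ j → s u (suc u + j))
    split rewrite sumTo-at n u (λ j → ind (s u j)) p | su | +-identityʳ (countTo u (s u)) = refl
    rows : sumTo u (rowAbove n s) + rowAbove n s u ≤ edgesℕ n s
    rows rewrite sumTo-at n u (rowAbove n s) p = m≤m+n _ _
    before : countTo u (s u) ≤ sumTo u (rowAbove n s)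
    before = sumTo-mono u (λ i i<u → below≤rowAbove n s u i sy p i<u)
    after : countTo r (λ j → s u (suc u + j)) ≤ rowAbove n s u
    after rewrite sumTo-at n u (λ j → ind ((u <ᵇ j) ∧ s u j)) p =
      ≤-trans (≤-reflexive (sumTo-cong r (λ j _ → cong (λ x → ind (x ∧ s u (suc u + j)))
                 (sym (<ᵇ-true {u} {suc u + j} (s≤s (m≤m+n u j)))))))
              (m≤n+m _ _)

  twoRows≤edges : ∀ m (s : ℕ → ℕ → Bool) → (∀ k l → s k l ≡ s l k) →
    countTo m (s m) + countTo m (s (suc m)) + ind (s m (suc m)) ≤ edgesℕ (m + 2) s
  twoRows≤edges m s sy = ≤-trans main (≤-trans (m≤m+n _ _) (≤-reflexive (sym lastRows)))
    where
    R = rowAbove (m + 2) s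
    lastlt : suc m < m + 2
    lastlt = subst (suc m <_) (+-comm 2 m) ≤-refl
    lastRows : edgesℕ (m + 2) s ≡ sumTo m R + R m + R (suc m)
    lastRows rewrite sumTo-split m 2 R | +-identityʳ m | +-suc m 0 | +-identityʳ m =
      sym (+-assoc (sumTo m R) _ _)
    pt : ∀ i → i < m → ind (s m i) + ind (s (suc m) i) ≤ R i
    pt i p = subst (_≤ R i)
               (cong₂ _+_ (cong ind (trans (cong (_∧ s i m) (<ᵇ-true p)) (sy i m)))
                          (cong ind (trans (cong (_∧ s i (suc m)) (<ᵇ-true (m<n⇒m<1+n p))) (sy i (suc m)))))
               (two-terms≤sumTo (m + 2) (λ j → ind ((i <ᵇ j) ∧ s i j)) m (suc m) ≤-refl lastlt)
    main : countTo m (s m) + countTo m (s (suc m)) + ind (s m (suc m)) ≤ sumTo m R + R m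
    main = +-mono-≤ (subst (_≤ sumTo m R) (sumTo-+ m _ _) (sumTo-mono m pt))
                    (subst (_≤ R m) (cong ind (cong (_∧ s m (suc m)) (<ᵇ-true {m} {suc m} ≤-refl)))
                       (term≤sumTo (m + 2) (λ j → ind ((m <ᵇ j) ∧ s m j)) (suc m) lastlt))

module Graph where
  open Counting
  open FinBridge

  labelℕ : ℕ → ℕ → Lab
  labelℕ t k =
    if k <ᵇ t then X 1 (suc k)
    else if k <ᵇ t + t then X 2 (suc (k ∸ t))
    else if k ≡ᵇ t + t then Y
    else Z

  adj : ℕ → ℕ → ℕ → ℕ → Bool
  adj a t k l = labAdj a (labelℕ t k) (labelℕ t l)

  y z : ℕ → ℕ
  y t = t + t
  z t = suc (t + t)

  labA : ∀ {t k} → k < t → labelℕ t k ≡ X 1 (suc k)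
  labA p rewrite <ᵇ-true p = refl

  labB : ∀ {t k} → k < t → labelℕ t (t + k) ≡ X 2 (suc k)
  labB {t} {k} p rewrite <ᵇ-false {t + k} {t} (λ q → <⇒≱ q (m≤m+n t k))
                       | <ᵇ-true (+-monoʳ-< t p) | m+n∸m≡n t k = refl

  labY : ∀ t → labelℕ t (y t) ≡ Y
  labY t rewrite <ᵇ-false {t + t} {t} (λ q → <⇒≱ q (m≤m+n t t))
               | <ᵇ-false {t + t} {t + t} (n≮n _) | ≡ᵇ-refl (t + t) = refl

  labZ : ∀ t → labelℕ t (z t) ≡ Z
  labZ t rewrite <ᵇ-false {suc (t + t)} {t} (λ q → <⇒≱ q (≤-trans (m≤m+n t t) (n≤1+n _)))
               | <ᵇ-false {suc (t + t)} {t + t} (λ q → <⇒≱ q (n≤1+n _))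
               | ≡ᵇ-false {suc (t + t)} {t + t} 1+n≢n = refl

  ≡ᵇ-sym : ∀ m n → (m ≡ᵇ n) ≡ (n ≡ᵇ m)
  ≡ᵇ-sym zero zero = refl
  ≡ᵇ-sym zero (suc n) = refl
  ≡ᵇ-sym (suc m) zero = refl
  ≡ᵇ-sym (suc m) (suc n) = ≡ᵇ-sym m n

  labAdj-sym : ∀ a p q → labAdj a p q ≡ labAdj a q p
  labAdj-sym a (X i j) (X i' j') rewrite ≡ᵇ-sym i i' | ≡ᵇ-sym j j' = refl
  labAdj-sym a (X i j) Y = refl
  labAdj-sym a (X i j) Z = refl
  labAdj-sym a Y (X i j) = refl
  labAdj-sym a Y Y = refl
  labAdj-sym a Y Z = refl
  labAdj-sym a Z (X i j) = refl
  labAdj-sym a Z Y = refl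
  labAdj-sym a Z Z = refl

  adj-sym : ∀ a t k l → adj a t k l ≡ adj a t l k
  adj-sym a t k l = labAdj-sym a (labelℕ t k) (labelℕ t l)

  H-sym : ∀ a t → Symmetric (H a t)
  H-sym a t u v = adj-sym a t (toℕ u) (toℕ v)

  lower-H : ∀ a t (d : Fin (t + t + 2)) k l → k < t + t + 2 → l < t + t + 2 →
    H a t (toFin d k) (toFin d l) ≡ adj a t k l
  lower-H a t d k l p q rewrite toℕ-toFin d k p | toℕ-toFin d l q = refl

  data View (t k : ℕ) : Set where
    vA : k < t → View t k
    vB : ∀ j → j < t → k ≡ t + j → View t k
    vY : k ≡ y t → View t k
    vZ : k ≡ z t → View t k

  view : ∀ t k → k < t + t + 2 → View t k
  view t k p with k <? t
  ... | yes q = vA q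
  ... | no q with k <? t + t
  ...   | yes r = vB (k ∸ t) (+-cancelˡ-< t _ _ (subst (_< t + t) (sym k≡) r)) (sym k≡)
    where k≡ = m+[n∸m]≡n (≮⇒≥ q)
  ...   | no r with k ≟ t + t
  ...     | yes s = vY s
  ...     | no s = vZ (≤-antisym (s≤s⁻¹ (subst (k <_) (+-comm (t + t) 2) p))
                                 (≤∧≢⇒< (≮⇒≥ r) (λ e → s (sym e))))

  module _ (a t : ℕ) where
    adjAA : ∀ {k l} → k < t → l < t → adj a t k l ≡ not (k ≡ᵇ l)
    adjAA p q rewrite labA p | labA q = refl

    adjBB : ∀ {k l} → k < t → l < t → adj a t (t + k) (t + l) ≡ not (k ≡ᵇ l)
    adjBB p q rewrite labB p | labB q = refl

    adjAB : ∀ {k l} → k < t → l < t → adj a t k (t + l) ≡ false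
    adjAB p q rewrite labA p | labB q = refl

    adjyA : ∀ {k} → k < t → adj a t (y t) k ≡ (k <ᵇ (a / 2 ∸ 1))
    adjyA {k} p rewrite labY t | labA p = ∨-identityʳ (k <ᵇ (a / 2 ∸ 1))

    adjyB : ∀ {k} → k < t → adj a t (y t) (t + k) ≡ ((a / 2 ∸ 1 <ᵇ suc k) ∧ (k <ᵇ a ∸ 1))
    adjyB p rewrite labY t | labB p = refl

    adjzA : ∀ {k} → k < t → adj a t (z t) k ≡ ((a / 2 ∸ 1 <ᵇ suc k) ∧ (k <ᵇ a ∸ 1))
    adjzA p rewrite labZ t | labA p = refl

    adjzB : ∀ {k} → k < t → adj a t (z t) (t + k) ≡ (k <ᵇ (a / 2 ∸ 1))
    adjzB {k} p rewrite labZ t | labB p = ∨-identityʳ (k <ᵇ (a / 2 ∸ 1))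

    adjyz : adj a t (y t) (z t) ≡ true
    adjyz rewrite labY t | labZ t = refl

    adjyy : adj a t (y t) (y t) ≡ false
    adjyy rewrite labY t = refl

    adjzz : adj a t (z t) (z t) ≡ false
    adjzz rewrite labZ t = refl

    adj-irrefl : ∀ k → k < t + t + 2 → adj a t k k ≡ false
    adj-irrefl k p with view t k p
    ... | vA q rewrite adjAA q q | ≡ᵇ-refl k = refl
    ... | vB j q refl rewrite adjBB q q | ≡ᵇ-refl j = refl
    ... | vY refl = adjyy
    ... | vZ refl = adjzz

module Arith where

  -- the hypothesis is the bound on |V(H)| = 2t + 2 of the statement
  orderBound : ∀ a b t → (a + b) ^ 2 ≤ 2 * b * t + 3 * a + 4 * b →
    b * (2 * a + b) + a * a ≤ b * (t + t + 2) + 2 * b + 3 * a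
  orderBound a b t h = subst₂ _≤_ (lhs a b) (rhs a b t) h
    where
    lhs : ∀ a b → (a + b) * ((a + b) * 1) ≡ b * (2 * a + b) + a * a
    lhs = solve-∀
    rhs : ∀ a b t → 2 * b * t + 3 * a + 4 * b ≡ b * (t + t + 2) + 2 * b + 3 * a
    rhs = solve-∀

  t-large : ∀ a b t → 1 ≤ a → a ≤ b → (a + b) ^ 2 ≤ 2 * b * t + 3 * a + 4 * b → a + a ≤ t + 3
  t-large a b t a1 ab h with a + a ≤? t + 3
  ... | yes p = p
  ... | no np = ⊥-elim (<-irrefl refl (≤-trans (big a a1 ab) chain))
    where
    t4 : t + 4 ≤ a + a
    t4 = subst (_≤ a + a) (sym (+-suc t 3)) (≰⇒> np)
    chain : (a + b) ^ 2 + 4 * b ≤ 2 * (b * (a + a)) + 3 * a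
    chain = ≤-trans (+-monoˡ-≤ (4 * b) h)
              (≤-trans (≤-reflexive (eq a b t)) (+-monoˡ-≤ (3 * a) (*-monoʳ-≤ 2 (*-monoʳ-≤ b t4))))
      where eq : ∀ a b t → 2 * b * t + 3 * a + 4 * b + 4 * b ≡ 2 * (b * (t + 4)) + 3 * a
            eq = solve-∀
    -- with b = a + d:  (a + b)² + 4b exceeds 2b·2a + 3a
    big : ∀ a → 1 ≤ a → a ≤ b → suc (2 * (b * (a + a)) + 3 * a) ≤ (a + b) ^ 2 + 4 * b
    big (suc a') _ ab' rewrite sym (m+[n∸m]≡n ab') =
      ≤-trans (m≤m+n _ ((b ∸ suc a') * (b ∸ suc a') + 4 * (b ∸ suc a') + a'))
              (≤-reflexive (expand a' (b ∸ suc a')))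
      where expand : ∀ a' d → suc (2 * ((suc a' + d) * (suc a' + suc a')) + 3 * suc a') + (d * d + 4 * d + a')
                              ≡ (suc a' + (suc a' + d)) * ((suc a' + (suc a' + d)) * 1) + 4 * (suc a' + d)
            expand = solve-∀

  -- if a + t ≤ D + 1 then 2a(2t + 2) ≤ (a + b)D, using 4a ≤ a + b and 2 ≤ a
  degreeSumBound : ∀ a b t D → 2 ≤ a → 3 * a ≤ b → a + t ≤ suc D → 2 * a * (t + t + 2) ≤ (a + b) * D
  degreeSumBound a b t D a2 ab hD = ≤-trans via4a (*-monoˡ-≤ D 4a≤a+b)
    where
    4a≤a+b : 4 * a ≤ a + b
    4a≤a+b = subst (_≤ a + b) (e a) (+-monoʳ-≤ a ab)
      where e : ∀ a → a + 3 * a ≡ 4 * a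
            e = solve-∀
    bound4a : 4 * a * 2 + 4 * a * t ≤ 4 * a * suc D
    bound4a = ≤-trans (+-monoˡ-≤ (4 * a * t) (*-monoʳ-≤ (4 * a) a2))
             (≤-trans (≤-reflexive (e a t)) (*-monoʳ-≤ (4 * a) hD))
      where e : ∀ a t → 4 * a * a + 4 * a * t ≡ 4 * a * (a + t)
            e = solve-∀
    via4a : 2 * a * (t + t + 2) ≤ 4 * a * D
    via4a = +-cancelʳ-≤ (4 * a) _ _ (subst₂ _≤_ (e1 a t) (e2 a D) bound4a)
      where
      e1 : ∀ a t → 4 * a * 2 + 4 * a * t ≡ 2 * a * (t + t + 2) + 4 * a
      e1 = solve-∀
      e2 : ∀ a D → 4 * a * suc D ≡ 4 * a * D + 4 * a
      e2 = solve-∀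

  -- Deleting p, q edges from y to A, B, r, w from z to A, B and e ∈ {0,1} for yz,
  -- with p + q + r + w + e ≤ 2m - 2, cannot isolate y from a side (p ≥ m - 1 or
  -- q ≥ m), z from a side (r ≥ m or w ≥ m - 1), and block A–z–y–B (r ≥ m,
  -- q ≥ m or e ≥ 1) all at once.
  crossingArith : ∀ m p q r w e → 1 ≤ m → p + q + (r + w) + e + 2 ≤ m + m →
    (m ∸ 1 ≤ p ⊎ m ≤ q) → (m ≤ r ⊎ m ∸ 1 ≤ w) → (m ≤ r ⊎ m ≤ q ⊎ 1 ≤ e) → ⊥
  crossingArith (suc m') p q r w e _ h = go
    where
    total : p + q + (r + w) + e ≤ m' + m'
    total = +-cancelʳ-≤ 2 _ _ (subst (p + q + (r + w) + e + 2 ≤_) (eq m') h)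
      where eq : ∀ m' → suc m' + suc m' ≡ m' + m' + 2
            eq = solve-∀
    tooMany : ∀ {P Q R W X} → P ≤ p → Q ≤ q → R ≤ r → W ≤ w → X ≤ e →
              suc (m' + m') ≡ P + Q + (R + W) + X → ⊥
    tooMany hp hq hr hw hx eq = <-irrefl refl
      (≤-trans (≤-reflexive eq) (≤-trans (+-mono-≤ (+-mono-≤ (+-mono-≤ hp hq) (+-mono-≤ hr hw)) hx) total))
    pr : ∀ m' → suc (m' + m') ≡ m' + 0 + (suc m' + 0) + 0
    pr = solve-∀
    pq : ∀ m' → suc (m' + m') ≡ m' + suc m' + (0 + 0) + 0
    pq = solve-∀
    pwe : ∀ m' → suc (m' + m') ≡ m' + 0 + (0 + m') + 1
    pwe = solve-∀
    qr : ∀ m' → suc (m' + m') ≡ 0 + suc m' + (m' + 0) + 0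
    qr = solve-∀
    qw : ∀ m' → suc (m' + m') ≡ 0 + suc m' + (0 + m') + 0
    qw = solve-∀
    go : (m' ≤ p ⊎ suc m' ≤ q) → (suc m' ≤ r ⊎ m' ≤ w) → (suc m' ≤ r ⊎ suc m' ≤ q ⊎ 1 ≤ e) → ⊥
    go (inj₁ hp) (inj₁ hr) _ = tooMany hp z≤n hr z≤n z≤n (pr m')
    go (inj₁ hp) (inj₂ hw) (inj₁ hr) = tooMany hp z≤n hr z≤n z≤n (pr m')
    go (inj₁ hp) (inj₂ hw) (inj₂ (inj₁ hq)) = tooMany hp hq z≤n z≤n z≤n (pq m')
    go (inj₁ hp) (inj₂ hw) (inj₂ (inj₂ he)) = tooMany hp z≤n z≤n hw he (pwe m')
    go (inj₂ hq) (inj₁ hr) _ = tooMany z≤n hq (≤-trans (n≤1+n m') hr) z≤n z≤n (qr m')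
    go (inj₂ hq) (inj₂ hw) _ = tooMany z≤n hq z≤n hw z≤n (qw m')

module Construction (a t m : ℕ) (a/2≡m : a / 2 ≡ m) (a≡m+m : a ≡ m + m) (2≤m : 2 ≤ m) (a<t : a < t) where
  open Counting
  open FinBridge
  open Graph

  N : ℕ
  N = t + t + 2

  a≤t : a ≤ t
  a≤t = <⇒≤ a<t

  m≤t : m ≤ t
  m≤t = ≤-trans (m≤m+n m m) (≤-trans (≤-reflexive (sym a≡m+m)) a≤t)

  0<t : 0 < t
  0<t = ≤-trans (s≤s z≤n) (≤-trans (≤-trans 2≤m (m≤m+n m m)) (≤-trans (≤-reflexive (sym a≡m+m)) a≤t))

  1≤N : 1 ≤ N
  1≤N = ≤-trans (s≤s z≤n) (m≤n+m 2 (t + t))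

  d : Fin N
  d = fromℕ< 1≤N

  A<N : ∀ {k} → k < t → k < N
  A<N p = ≤-trans p (≤-trans (m≤m+n t t) (m≤m+n (t + t) 2))

  B<N : ∀ {k} → k < t → t + k < N
  B<N p = ≤-trans (+-monoʳ-< t p) (m≤m+n (t + t) 2)

  z<N : z t < N
  z<N = ≤-reflexive (sym (trans (+-suc (t + t) 1) (cong suc (+-comm (t + t) 1))))

  y<N : y t < N
  y<N = ≤-trans (n≤1+n _) z<N

  countTo-vertices : ∀ (g : ℕ → Bool) → countTo N g ≡
    countTo t g + countTo t (λ k → g (t + k)) + ind (g (y t)) + ind (g (z t))
  countTo-vertices g
    rewrite sumTo-split (t + t) 2 (λ k → ind (g k)) | +-identityʳ (t + t) | +-suc (t + t) 0
          | +-identityʳ (t + t) | sumTo-split t t (λ k → ind (g k)) =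
    sym (+-assoc (countTo t g + countTo t (λ k → g (t + k))) (ind (g (t + t))) (ind (g (suc (t + t)))))

  small-range : countTo t (λ k → k <ᵇ (a / 2 ∸ 1)) ≡ m ∸ 1
  small-range rewrite a/2≡m = trans (countTo-<ᵇ t (m ∸ 1)) (m≥n⇒m⊓n≡n (≤-trans (m∸n≤m m 1) m≤t))

  m+m-1≡a-1 : m + (m ∸ 1) ≡ a ∸ 1
  m+m-1≡a-1 = trans (sym (+-∸-assoc m {m} {1} (≤-trans (s≤s z≤n) 2≤m))) (cong (_∸ 1) (sym a≡m+m))

  large-range : countTo t (λ k → (a / 2 ∸ 1 <ᵇ suc k) ∧ (k <ᵇ a ∸ 1)) ≡ m
  large-range rewrite a/2≡m =
    +-cancelʳ-≡ _ _ _ (trans (countTo-range t (m ∸ 1) (a ∸ 1) lo≤hi (≤-trans (m∸n≤m a 1) a≤t))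
                             (sym m+m-1≡a-1))
    where lo≤hi : m ∸ 1 ≤ a ∸ 1
          lo≤hi = ∸-monoˡ-≤ 1 (≤-trans (m≤m+n m m) (≤-reflexive (sym a≡m+m)))

  yA : countTo t (adj a t (y t)) ≡ m ∸ 1
  yA = trans (sumTo-cong t (λ k p → cong ind (adjyA a t p))) small-range

  yB : countTo t (λ k → adj a t (y t) (t + k)) ≡ m
  yB = trans (sumTo-cong t (λ k p → cong ind (adjyB a t p))) large-range

  zA : countTo t (adj a t (z t)) ≡ m
  zA = trans (sumTo-cong t (λ k p → cong ind (adjzA a t p))) large-range

  zB : countTo t (λ k → adj a t (z t) (t + k)) ≡ m ∸ 1
  zB = trans (sumTo-cong t (λ k p → cong ind (adjzB a t p))) small-range

  m-1+m+1≡a : m ∸ 1 + m + 1 ≡ a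
  m-1+m+1≡a = begin
    m ∸ 1 + m + 1   ≡⟨ cong (_+ 1) (+-comm (m ∸ 1) m) ⟩
    m + (m ∸ 1) + 1 ≡⟨ +-assoc m (m ∸ 1) 1 ⟩
    m + (m ∸ 1 + 1) ≡⟨ cong (m +_) (m∸n+n≡m {m} {1} (≤-trans (s≤s z≤n) 2≤m)) ⟩
    m + m           ≡⟨ sym a≡m+m ⟩
    a               ∎
    where open ≡-Reasoning

  degY : countTo N (adj a t (y t)) ≡ a
  degY rewrite countTo-vertices (adj a t (y t)) | yA | yB | adjyy a t | adjyz a t
             | +-identityʳ (m ∸ 1 + m) = m-1+m+1≡a

  degZ : countTo N (adj a t (z t)) ≡ a
  degZ rewrite countTo-vertices (adj a t (z t)) | zA | zB | adjzz a t
             | adj-sym a t (z t) (y t) | adjyz a t =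
    trans (+-identityʳ (m + (m ∸ 1) + 1)) (trans (cong (_+ 1) (+-comm m (m ∸ 1))) m-1+m+1≡a)

  degA : ∀ k → k < t → t ≤ suc (countTo N (adj a t k))
  degA k p = ≤-trans (countTo-allBut t (adj a t k) k (λ w q → adjAA a t p q))
                     (s≤s (sumTo-monoˡ t N _ (≤-trans (m≤m+n t t) (m≤m+n (t + t) 2))))

  degB : ∀ k → k < t → t ≤ suc (countTo N (adj a t (t + k)))
  degB k p = ≤-trans (countTo-allBut t (λ w → adj a t (t + k) (t + w)) k (λ w q → adjBB a t p q))
                     (s≤s (≤-trans (m≤n+m _ (countTo t (adj a t (t + k))))
                       (≤-trans (m≤m+n _ _) (≤-trans (m≤m+n _ _)
                         (≤-reflexive (sym (countTo-vertices (adj a t (t + k)))))))))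

  degX : ∀ k → k < N → ¬ k ≡ y t → ¬ k ≡ z t → t ≤ suc (countTo N (adj a t k))
  degX k kN ny nz with view t k kN
  ... | vA p = degA k p
  ... | vB j p refl = degB j p
  ... | vY e = ⊥-elim (ny e)
  ... | vZ e = ⊥-elim (nz e)

  -- δ(H) ≥ a: y, z have degree a, the other vertices degree ≥ t - 1 ≥ a
  degree≥a : ∀ k → k < N → a ≤ countTo N (adj a t k)
  degree≥a k kN with view t k kN
  ... | vY refl = ≤-reflexive (sym degY)
  ... | vZ refl = ≤-reflexive (sym degZ)
  ... | vA p = s≤s⁻¹ (≤-trans a<t (degA k p))
  ... | vB j p refl = s≤s⁻¹ (≤-trans a<t (degB j p))

  deg-H : ∀ (v : Fin N) → deg (H a t) v ≡ countTo N (adj a t (toℕ v))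
  deg-H v = count≡countTo N (H a t v) _ (λ i → refl)

  minDegree : MinDegGE (H a t) a
  minDegree v = subst (a ≤_) (sym (deg-H v)) (degree≥a (toℕ v) (toℕ<n v))

  -- two non-adjacent vertices are not both in {y, z}, so one has degree ≥ t - 1
  nonAdjacentDegrees : (u v : Fin N) → ¬ u ≡ v → H a t u v ≡ false →
    a + t ≤ suc (deg (H a t) u + deg (H a t) v)
  nonAdjacentDegrees u v u≢v huv =
    subst (λ x → a + t ≤ suc x) (sym (cong₂ _+_ (deg-H u) (deg-H v))) (cases (hub (toℕ u)) (hub (toℕ v)))
    where
    du = countTo N (adj a t (toℕ u))
    dv = countTo N (adj a t (toℕ v))
    oneOutside : ∀ k l → k < N → ¬ k ≡ y t → ¬ k ≡ z t → l < N →
      a + t ≤ suc (countTo N (adj a t k) + countTo N (adj a t l))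
    oneOutside k l kN ny nz lN = subst (a + t ≤_) (e _ _) (+-mono-≤ (degree≥a l lN) (degX k kN ny nz))
      where e : ∀ x y → y + suc x ≡ suc (x + y)
            e = solve-∀
    Hub : ℕ → Set
    Hub k = k ≡ y t ⊎ k ≡ z t
    Outside : ℕ → Set
    Outside k = ¬ k ≡ y t × ¬ k ≡ z t
    hub : ∀ k → Hub k ⊎ Outside k
    hub k with k ≟ y t | k ≟ z t
    ... | yes e | _ = inj₁ (inj₁ e)
    ... | no _ | yes e = inj₁ (inj₂ e)
    ... | no n1 | no n2 = inj₂ (n1 , n2)
    notBothHubs : Hub (toℕ u) → Hub (toℕ v) → ⊥
    notBothHubs (inj₁ e1) (inj₁ e2) = u≢v (toℕ-injective (trans e1 (sym e2)))
    notBothHubs (inj₂ e1) (inj₂ e2) = u≢v (toℕ-injective (trans e1 (sym e2)))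
    notBothHubs (inj₁ e1) (inj₂ e2) with trans (sym huv) (trans (cong₂ (adj a t) e1 e2) (adjyz a t))
    ... | ()
    notBothHubs (inj₂ e1) (inj₁ e2)
      with trans (sym huv) (trans (cong₂ (adj a t) e1 e2) (trans (adj-sym a t (z t) (y t)) (adjyz a t)))
    ... | ()
    cases : Hub (toℕ u) ⊎ Outside (toℕ u) → Hub (toℕ v) ⊎ Outside (toℕ v) → a + t ≤ suc (du + dv)
    cases (inj₂ (n1 , n2)) _ = oneOutside (toℕ u) (toℕ v) (toℕ<n u) n1 n2 (toℕ<n v)
    cases (inj₁ _) (inj₂ (n1 , n2)) =
      subst (λ x → a + t ≤ suc x) (+-comm dv du) (oneOutside (toℕ v) (toℕ u) (toℕ<n v) n1 n2 (toℕ<n u))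
    cases (inj₁ p) (inj₁ q) = ⊥-elim (notBothHubs p q)

  module Subgraph (F : Rel N) (F-sym : Symmetric F) (F⊆H : F ⊆E H a t) where
    f : ℕ → ℕ → Bool
    f = lower d F

    f-sym : ∀ k l → f k l ≡ f l k
    f-sym = lower-sym d F F-sym

    f⊆adj : ∀ k l → k < N → l < N → f k l ≡ true → adj a t k l ≡ true
    f⊆adj k l p q e = trans (sym (lower-H a t d k l p q)) (F⊆H (toFin d k) (toFin d l) e)

    f-nonEdge : ∀ k l → k < N → l < N → adj a t k l ≡ false → f k l ≡ false
    f-nonEdge k l p q e with f k l in fe
    ... | false = refl
    ... | true = trans (sym (f⊆adj k l p q fe)) e

    f-irrefl : ∀ k → k < N → f k k ≡ false
    f-irrefl k p = f-nonEdge k k p p (adj-irrefl a t k p)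

    f-noB : ∀ k → k < t → countTo t (λ j → f k (t + j)) ≡ 0
    f-noB k p = sumTo-zero t _ (λ j q → cong ind (f-nonEdge k (t + j) (A<N p) (B<N q) (adjAB a t p q)))

    f-row : ∀ k → k < t → countTo N (f k) ≡ countTo t (f k) + (ind (f k (y t)) + ind (f k (z t)))
    f-row k p rewrite countTo-vertices (f k) | f-noB k p | +-identityʳ (countTo t (f k)) =
      +-assoc (countTo t (f k)) _ _

    degreeSumA : Σ ℕ λ q → sumTo t (λ k → countTo N (f k)) ≡ q + q + (countTo t (f (y t)) + countTo t (f (z t)))
    degreeSumA with handshake t f f-sym (λ k p → f-irrefl k (A<N p))
    ... | q , inside = q , (begin
      sumTo t (λ k → countTo N (f k))
        ≡⟨ sumTo-cong t f-row ⟩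
      sumTo t (λ k → countTo t (f k) + (ind (f k (y t)) + ind (f k (z t))))
        ≡⟨ sumTo-+ t _ _ ⟩
      sumTo t (λ k → countTo t (f k)) + sumTo t (λ k → ind (f k (y t)) + ind (f k (z t)))
        ≡⟨ cong₂ _+_ inside (sumTo-+ t _ _) ⟩
      q + q + (sumTo t (λ k → ind (f k (y t))) + sumTo t (λ k → ind (f k (z t))))
        ≡⟨ cong (q + q +_) (cong₂ _+_ (column (y t)) (column (z t))) ⟩
      q + q + (countTo t (f (y t)) + countTo t (f (z t))) ∎)
      where
      open ≡-Reasoning
      column : ∀ v → sumTo t (λ k → ind (f k v)) ≡ countTo t (f v)
      column v = sumTo-cong t (λ k _ → cong ind (f-sym k v))

    f-full : ∀ v → v < N → countTo N (adj a t v) ≡ a → a ≤ countTo N (f v) →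
      ∀ k → k < N → f v k ≡ adj a t v k
    f-full v p dv fv =
      countTo-squeeze N (f v) (adj a t v) (λ l q → f⊆adj v l p q) (subst (_≤ countTo N (f v)) (sym dv) fv)

  -- H has no even [a,b]-factor: the degree sum of F over A would be odd
  noEvenFactor : ∀ b → ¬ HasEvenFactor (H a t) a b
  noEvenFactor b (F , F-sym , F⊆H , Fdeg) =
    odd-not-even (q + (m ∸ 1)) (subst (2 ∣_) (trans sumA (odd q m 2≤m)) evenSum)
    where
    open Subgraph F F-sym F⊆H
    fdeg : ∀ k → k < N → a ≤ countTo N (f k)
    fdeg k p = subst (a ≤_) (deg-at d F k p) (proj₁ (proj₂ (Fdeg (toFin d k))))
    evenSum : 2 ∣ sumTo t (λ k → countTo N (f k))
    evenSum = sumTo-even t _ (λ k p → subst (2 ∣_) (deg-at d F k (A<N p)) (proj₁ (Fdeg (toFin d k))))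
    keepsA : ∀ v → v < N → countTo N (adj a t v) ≡ a → countTo t (f v) ≡ countTo t (adj a t v)
    keepsA v p dv = sumTo-cong t (λ k q → cong ind (f-full v p dv (fdeg v p) k (A<N q)))
    q = proj₁ degreeSumA
    sumA : sumTo t (λ k → countTo N (f k)) ≡ q + q + (m ∸ 1 + m)
    sumA = trans (proj₂ degreeSumA)
      (cong (q + q +_) (cong₂ _+_ (trans (keepsA (y t) y<N degY) yA) (trans (keepsA (z t) z<N degZ) zA)))
    odd : ∀ q m → 2 ≤ m → q + q + (m ∸ 1 + m) ≡ q + (m ∸ 1) + (q + (m ∸ 1)) + 1
    odd q (suc m') _ = shuffle q m'
      where shuffle : ∀ q m' → q + q + (m' + suc m') ≡ q + m' + (q + m') + 1
            shuffle = solve-∀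

  crosses : ℕ → ℕ → Bool
  crosses k l = (k <ᵇ t) xor (l <ᵇ t)

  cutℕ : ℕ → ℕ → Bool
  cutℕ k l = adj a t k l ∧ crosses k l

  cut : Rel N
  cut u v = cutℕ (toℕ u) (toℕ v)

  cut-sym : Symmetric cut
  cut-sym u v rewrite xor-comm (toℕ u <ᵇ t) (toℕ v <ᵇ t) | adj-sym a t (toℕ u) (toℕ v) = refl

  cut⊆H : cut ⊆E H a t
  cut⊆H u v e = ∧-conicalˡ _ _ e

  cutRow : ℕ → ℕ
  cutRow i = countTo N (λ j → (i <ᵇ j) ∧ cutℕ i j)

  cutℕ-sameSide : ∀ k l → (k <ᵇ t) ≡ (l <ᵇ t) → cutℕ k l ≡ false
  cutℕ-sameSide k l e =
    trans (cong (adj a t k l ∧_) (trans (cong (_xor (l <ᵇ t)) e) (xor-same (l <ᵇ t)))) (∧-zeroʳ (adj a t k l))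
    where xor-same : ∀ x → x xor x ≡ false
          xor-same false = refl
          xor-same true = refl

  ind-later-cut : ∀ i j → (i <ᵇ t) ≡ (j <ᵇ t) → ind ((i <ᵇ j) ∧ cutℕ i j) ≡ 0
  ind-later-cut i j e = cong ind (trans (cong ((i <ᵇ j) ∧_) (cutℕ-sameSide i j e)) (∧-zeroʳ (i <ᵇ j)))

  ind-∧∧ : ∀ x h c → ind (x ∧ (h ∧ c)) ≤ ind h
  ind-∧∧ false h c = z≤n
  ind-∧∧ true false c = z≤n
  ind-∧∧ true true false = z≤n
  ind-∧∧ true true true = ≤-refl

  -- rows of vertices outside A are empty: no vertex outside A crosses to a later one
  cutRow-outside : ∀ i → ¬ i < t → cutRow i ≡ 0
  cutRow-outside i p = sumTo-zero N _ (λ j _ → entry j)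
    where entry : ∀ j → ind ((i <ᵇ j) ∧ cutℕ i j) ≡ 0
          entry j with j <? t
          ... | yes q = cong (λ c → ind (c ∧ cutℕ i j)) (<ᵇ-false {i} {j} (λ r → p (<-trans r q)))
          ... | no q = ind-later-cut i j (trans (<ᵇ-false p) (sym (<ᵇ-false q)))

  cut-insideA : ∀ i → i < t → countTo t (λ j → (i <ᵇ j) ∧ cutℕ i j) ≡ 0
  cut-insideA i p = sumTo-zero t _ entry
    where entry : ∀ j → j < t → ind ((i <ᵇ j) ∧ cutℕ i j) ≡ 0
          entry j q = ind-later-cut i j (trans (<ᵇ-true p) (sym (<ᵇ-true q)))

  cut-AB : ∀ i → i < t → countTo t (λ j → (i <ᵇ t + j) ∧ cutℕ i (t + j)) ≡ 0
  cut-AB i p = sumTo-zero t _ entry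
    where entry : ∀ j → j < t → ind ((i <ᵇ t + j) ∧ cutℕ i (t + j)) ≡ 0
          entry j q rewrite adjAB a t p q with i <ᵇ t + j
          ... | true = refl
          ... | false = refl

  cutRow-A : ∀ i → i < t → cutRow i ≤ ind (adj a t i (y t)) + ind (adj a t i (z t))
  cutRow-A i p rewrite countTo-vertices (λ j → (i <ᵇ j) ∧ cutℕ i j) | cut-insideA i p | cut-AB i p =
    +-mono-≤ (ind-∧∧ (i <ᵇ y t) (adj a t i (y t)) _) (ind-∧∧ (i <ᵇ z t) (adj a t i (z t)) _)

  cut-edgesℕ : edgesℕ N cutℕ ≤ m ∸ 1 + m
  cut-edgesℕ = begin
    edgesℕ N cutℕ
      ≡⟨ trans (cong (λ x → sumTo x cutRow) (+-assoc t t 2)) (sumTo-split t (t + 2) cutRow) ⟩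
    sumTo t cutRow + sumTo (t + 2) (λ j → cutRow (t + j))
      ≡⟨ cong (sumTo t cutRow +_) (sumTo-zero (t + 2) _ (λ j _ → cutRow-outside (t + j) (t+j≮t j))) ⟩
    sumTo t cutRow + 0
      ≤⟨ +-monoˡ-≤ 0 (sumTo-mono t cutRow-A) ⟩
    sumTo t (λ i → ind (adj a t i (y t)) + ind (adj a t i (z t))) + 0
      ≡⟨ trans (+-identityʳ _) (sumTo-+ t _ _) ⟩
    sumTo t (λ i → ind (adj a t i (y t))) + sumTo t (λ i → ind (adj a t i (z t)))
      ≡⟨ cong₂ _+_ (trans (column (y t)) yA) (trans (column (z t)) zA) ⟩
    m ∸ 1 + m ∎
    where
    open ≤-Reasoning
    t+j≮t : ∀ j → ¬ t + j < t
    t+j≮t j q = <⇒≱ q (m≤m+n t j)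
    column : ∀ v → sumTo t (λ i → ind (adj a t i v)) ≡ countTo t (adj a t v)
    column v = sumTo-cong t (λ i _ → cong ind (adj-sym a t i v))

  cut-size : edgeCount cut < a
  cut-size = subst (_< a) (sym (trans (edgeCount≡edgesℕ d cut) (sumTo-cong N (λ i p → sumTo-cong N (λ j q →
               cong (λ x → ind ((i <ᵇ j) ∧ x)) (cong₂ cutℕ (toℕ-toFin d i p) (toℕ-toFin d j q)))))))
               (≤-trans (s≤s cut-edgesℕ) (≤-reflexive (trans (+-comm 1 _) m-1+m+1≡a)))

  stayInA : ∀ {u v} → Reach (removeEdges (H a t) cut) u v → toℕ u < t → toℕ v < t
  stayInA here p = p
  stayInA (step {u} {w} e r) p with toℕ w <? t
  ... | yes q = stayInA r q
  ... | no q = ⊥-elim (crossingRemoved _ _ (adj a t (toℕ u) (toℕ w)) (<ᵇ-true p) (<ᵇ-false q) e)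
    where crossingRemoved : ∀ x x' h → x ≡ true → x' ≡ false → (h ∧ not (h ∧ (x xor x'))) ≡ true → ⊥
          crossingRemoved .true .false true refl refl ()
          crossingRemoved .true .false false refl refl ()

  -- y is not reachable from vertex 0 ∈ A in H - cut
  notAEdgeConnected : ¬ KEdgeConnected (H a t) a
  notAEdgeConnected KE = <⇒≱ y<t (m≤m+n t t)
    where
    y<t : y t < t
    y<t = subst (_< t) (toℕ-toFin d (y t) y<N)
            (stayInA (KE cut cut-sym cut⊆H cut-size d (toFin d (y t))) (subst (_< t) (sym (toℕ-fromℕ< 1≤N)) 0<t))

  module Deletion (2a≤t+3 : a + a ≤ t + 3) (S : Rel N) (S-sym : Symmetric S) (S⊆H : S ⊆E H a t)
                  (few : edgeCount S < a ∸ 1) where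
    open Subgraph S S-sym S⊆H renaming (f to s; f-sym to s-sym; f-irrefl to s-irrefl)
    open EdgeBounds
    open Arith using (crossingArith)

    E : ℕ
    E = edgesℕ N s

    E+2≤a : E + 2 ≤ a
    E+2≤a = subst (_≤ a) (sym (+-suc E 1))
      (subst (suc E + 1 ≤_) (m∸n+n≡m 1≤a) (+-monoˡ-≤ 1 (subst (_< a ∸ 1) (edgeCount≡edgesℕ d S) few)))
      where 1≤a : 1 ≤ a
            1≤a = ≤-trans (s≤s z≤n) (≤-trans 2≤m (≤-trans (m≤m+n m m) (≤-reflexive (sym a≡m+m))))

    2E<t : E + E < t
    2E<t = +-cancelʳ-≤ 4 _ _ (≤-trans (≤-reflexive (eq E)) (≤-trans (s≤s (+-mono-≤ E+2≤a E+2≤a))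
             (≤-trans (s≤s 2a≤t+3) (≤-reflexive (sym (+-suc t 3))))))
      where eq : ∀ E → suc (E + E) + 4 ≡ suc (E + 2 + (E + 2))
            eq = solve-∀

    degS : ∀ k → k < N → countTo N (s k) ≤ E
    degS k p = degree≤edges N s k s-sym (s-irrefl k p) p

    G' : Rel N
    G' = removeEdges (H a t) S

    G'-sym : Symmetric G'
    G'-sym u v rewrite H-sym a t u v | S-sym u v = refl

    g' : ℕ → ℕ → Bool
    g' k l = adj a t k l ∧ not (s k l)

    Walk : ℕ → ℕ → Set
    Walk k l = Reach G' (toFin d k) (toFin d l)

    edge : ∀ {k l} → k < N → l < N → g' k l ≡ true → Walk k l
    edge {k} {l} p q e = step (trans (cong (_∧ not (s k l)) (lower-H a t d k l p q)) e) here

    _⁀_ : ∀ {k l j} → Walk k l → Walk l j → Walk k j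
    p ⁀ q = Reach-trans p q

    reverse : ∀ {k l} → Walk k l → Walk l k
    reverse = Reach-sym G'-sym

    -- A clique K_t = {o, …, o + t - 1} of H stays connected in G': o + k and o + l
    -- have a common G'-neighbour (or are adjacent), since t > 2E.
    module Clique (o : ℕ) (o+t≤N : o + t ≤ N)
                 (complete : ∀ w w' → w < t → w' < t → adj a t (o + w) (o + w') ≡ not (w ≡ᵇ w')) where
      near : ℕ → ℕ → Bool
      near k w = (w ≡ᵇ k) ∨ g' (o + k) (o + w)

      in-clique : ∀ {k} → k < t → o + k < N
      in-clique kt = <-≤-trans (+-monoʳ-< o kt) o+t≤N

      near-many : ∀ k → k < t → t ≤ countTo t (near k) + E
      near-many k kt = ≤-trans (≤-reflexive (sym (countTo-all t)))
                       (≤-trans (sumTo-mono t pt)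
                       (≤-trans (≤-reflexive (sumTo-+ t _ _)) (+-monoʳ-≤ (countTo t (near k)) deleted)))
        where
        pt : ∀ w → w < t → 1 ≤ ind (near k w) + ind (s (o + k) (o + w))
        pt w wt with w ≟ k
        ... | yes refl rewrite ≡ᵇ-refl w = s≤s z≤n
        ... | no ne rewrite ≡ᵇ-false ne | complete k w kt wt | ≡ᵇ-false {k} {w} (λ q → ne (sym q))
          with s (o + k) (o + w)
        ...   | true = ≤-refl
        ...   | false = s≤s z≤n
        deleted : countTo t (λ w → s (o + k) (o + w)) ≤ E
        deleted = ≤-trans (m≤n+m _ (countTo o (s (o + k))))
                  (≤-trans (≤-reflexive (sym (sumTo-split o t _)))
                  (≤-trans (sumTo-monoˡ (o + t) N _ o+t≤N) (degS (o + k) (in-clique kt))))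

      common : ∀ k l → k < t → l < t → 0 < countTo t (λ w → near k w ∧ near l w)
      common k l kt lt with 0 <? countTo t (λ w → near k w ∧ near l w)
      ... | yes q = q
      ... | no q = ⊥-elim (<⇒≱ 2E<t (+-cancelˡ-≤ t _ _ bound))
        where
        c = countTo t (λ w → near k w ∧ near l w)
        bound : t + t ≤ t + (E + E)
        bound = begin
          t + t
            ≤⟨ +-mono-≤ (near-many k kt) (near-many l lt) ⟩
          countTo t (near k) + E + (countTo t (near l) + E)
            ≡⟨ shuffle (countTo t (near k)) (countTo t (near l)) E ⟩
          countTo t (near k) + countTo t (near l) + (E + E)
            ≤⟨ +-monoˡ-≤ (E + E) (countTo-∩ t (near k) (near l)) ⟩
          t + c + (E + E)
            ≡⟨ cong (λ x → t + x + (E + E)) (n≤0⇒n≡0 (≮⇒≥ q)) ⟩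
          t + 0 + (E + E)
            ≡⟨ cong (_+ (E + E)) (+-identityʳ t) ⟩
          t + (E + E) ∎
          where
          open ≤-Reasoning
          shuffle : ∀ x y E → x + E + (y + E) ≡ x + y + (E + E)
          shuffle = solve-∀

      toNear : ∀ k w → k < t → w < t → near k w ≡ true → Walk (o + k) (o + w)
      toNear k w kt wt e with w ≡ᵇ k in eq
      ... | true = subst (λ x → Walk (o + k) (o + x)) (sym (≡ᵇ-sound eq)) here
      ... | false = edge (in-clique kt) (in-clique wt) e

      connectedClique : ∀ k l → k < t → l < t → Walk (o + k) (o + l)
      connectedClique k l kt lt with countTo-witness t _ (common k l kt lt)
      ... | w , wt , both =
        toNear k w kt wt (∧-conicalˡ _ _ both) ⁀ reverse (toNear l w lt wt (∧-conicalʳ _ _ both))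

    toA0 : ∀ k → k < t → Walk k 0
    toA0 k p = Clique.connectedClique 0 (≤-trans (m≤m+n t t) (m≤m+n (t + t) 2)) (λ w w' p q → adjAA a t p q) k 0 p 0<t

    toB0 : ∀ k → k < t → Walk (t + k) t
    toB0 k p = subst (Walk (t + k)) (+-identityʳ t)
      (Clique.connectedClique t (m≤m+n (t + t) 2) (λ w w' p q → adjBB a t p q) k 0 p 0<t)

    survivors : ∀ v (h : ℕ → ℕ) →
      countTo t (λ k → adj a t v (h k)) ≤ countTo t (λ k → g' v (h k)) + countTo t (λ k → s v (h k))
    survivors v h = countTo-∧not t (λ k → adj a t v (h k)) (λ k → s v (h k))

    survivesOrDeleted : ∀ {x c e} → c ≤ x + e → 0 < x ⊎ c ≤ e
    survivesOrDeleted {zero} h = inj₂ h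
    survivesOrDeleted {suc x} h = inj₁ (s≤s z≤n)

    through : ∀ v → v < N → 0 < countTo t (g' v) → 0 < countTo t (λ k → g' v (t + k)) → Walk 0 t
    through v vN toA toB with countTo-witness t _ toA | countTo-witness t _ toB
    ... | k , kt , e1 | l , lt , e2 =
      reverse (toA0 k kt) ⁀ (reverse (edge vN (A<N kt) e1) ⁀ (edge vN (B<N lt) e2 ⁀ toB0 l lt))

    hubJoinsOrMisses : ∀ v → v < N → ∀ {cA cB} →
      cA ≡ countTo t (adj a t v) → cB ≡ countTo t (λ k → adj a t v (t + k)) →
      Walk 0 t ⊎ (cA ≤ countTo t (s v) ⊎ cB ≤ countTo t (λ k → s v (t + k)))
    hubJoinsOrMisses v vN refl refl
      with survivesOrDeleted (survivors v (λ k → k)) | survivesOrDeleted (survivors v (t +_))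
    ... | inj₁ toA | inj₁ toB = inj₁ (through v vN toA toB)
    ... | inj₂ lostA | _ = inj₂ (inj₁ lostA)
    ... | inj₁ _ | inj₂ lostB = inj₂ (inj₂ lostB)

    deletedAtHubs : countTo t (s (y t)) + countTo t (λ k → s (y t) (t + k))
                    + (countTo t (s (z t)) + countTo t (λ k → s (z t) (t + k))) + ind (s (y t) (z t)) + 2 ≤ m + m
    deletedAtHubs = ≤-trans (+-monoˡ-≤ 2 (subst (_≤ E)
      (cong₂ (λ x w → x + w + ind (s (y t) (z t))) (sumTo-split t t _) (sumTo-split t t _))
      (twoRows≤edges (t + t) s s-sym))) (≤-trans E+2≤a (≤-reflexive a≡m+m))

    blocked : m ∸ 1 ≤ countTo t (s (y t)) ⊎ m ≤ countTo t (λ k → s (y t) (t + k)) →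
              m ≤ countTo t (s (z t)) ⊎ m ∸ 1 ≤ countTo t (λ k → s (z t) (t + k)) →
              m ≤ countTo t (s (z t)) ⊎ m ≤ countTo t (λ k → s (y t) (t + k)) ⊎ 1 ≤ ind (s (y t) (z t)) → ⊥
    blocked = crossingArith m _ _ _ _ _ (≤-trans (s≤s z≤n) 2≤m) deletedAtHubs

    viaZY : 0 < countTo t (g' (z t)) → s (y t) (z t) ≡ false → 0 < countTo t (λ k → g' (y t) (t + k)) → Walk 0 t
    viaZY zToA yz yToB with countTo-witness t _ zToA | countTo-witness t _ yToB
    ... | k , kt , e1 | l , lt , e2 =
      reverse (toA0 k kt) ⁀ (reverse (edge z<N (A<N kt) e1) ⁀ (edge z<N y<N zy ⁀ (edge y<N (B<N lt) e2 ⁀ toB0 l lt)))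
      where zy : g' (z t) (y t) ≡ true
            zy = cong₂ (λ h c → h ∧ not c) (trans (adj-sym a t (z t) (y t)) (adjyz a t)) (trans (s-sym (z t) (y t)) yz)

    viaZYSurvives : m ∸ 1 ≤ countTo t (s (y t)) ⊎ m ≤ countTo t (λ k → s (y t) (t + k)) →
                    m ≤ countTo t (s (z t)) ⊎ m ∸ 1 ≤ countTo t (λ k → s (z t) (t + k)) → Walk 0 t
    viaZYSurvives yMisses zMisses =
      decide (survivesOrDeleted (survivors (z t) (λ k → k))) (survivesOrDeleted (survivors (y t) (t +_)))
             (s (y t) (z t)) refl
      where
      decide : 0 < countTo t (g' (z t)) ⊎ countTo t (adj a t (z t)) ≤ countTo t (s (z t)) →
               0 < countTo t (λ k → g' (y t) (t + k)) ⊎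
                 countTo t (λ k → adj a t (y t) (t + k)) ≤ countTo t (λ k → s (y t) (t + k)) →
               (b : Bool) → s (y t) (z t) ≡ b → Walk 0 t
      decide (inj₁ zToA) (inj₁ yToB) false yz = viaZY zToA yz yToB
      decide (inj₁ _) (inj₁ _) true yz =
        ⊥-elim (blocked yMisses zMisses (inj₂ (inj₂ (subst (λ b → 1 ≤ ind b) (sym yz) ≤-refl))))
      decide (inj₂ zLostA) _ _ _ =
        ⊥-elim (blocked yMisses zMisses (inj₁ (subst (_≤ countTo t (s (z t))) zA zLostA)))
      decide (inj₁ _) (inj₂ yLostB) _ _ =
        ⊥-elim (blocked yMisses zMisses (inj₂ (inj₁ (subst (_≤ countTo t (λ k → s (y t) (t + k))) yB yLostB))))

    cross : Walk 0 t
    cross = join (hubJoinsOrMisses (y t) y<N (sym yA) (sym yB)) (hubJoinsOrMisses (z t) z<N (sym zA) (sym zB))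
      where
      join : Walk 0 t ⊎ (m ∸ 1 ≤ countTo t (s (y t)) ⊎ m ≤ countTo t (λ k → s (y t) (t + k))) →
             Walk 0 t ⊎ (m ≤ countTo t (s (z t)) ⊎ m ∸ 1 ≤ countTo t (λ k → s (z t) (t + k))) → Walk 0 t
      join (inj₁ walk) _ = walk
      join (inj₂ _) (inj₁ walk) = walk
      join (inj₂ yMisses) (inj₂ zMisses) = viaZYSurvives yMisses zMisses

    -- G' keeps an edge from v to some w ∉ {v, v'} when v has H-degree a > E + 1
    otherNeighbour : ∀ v v' → v < N → countTo N (adj a t v) ≡ a →
      Σ ℕ λ w → w < N × g' v w ≡ true × ¬ w ≡ v' × ¬ w ≡ v
    otherNeighbour v v' vN dv with countTo-witness N (λ w → g' v w ∧ not (w ≡ᵇ v')) positive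
      where
      kept : ℕ
      kept = countTo N (λ w → g' v w ∧ not (w ≡ᵇ v'))
      bound : a ≤ kept + 1 + E
      bound = begin
        a                                  ≡⟨ sym dv ⟩
        countTo N (adj a t v)              ≤⟨ countTo-∧not N (adj a t v) (s v) ⟩
        countTo N (g' v) + countTo N (s v) ≤⟨ +-mono-≤ (countTo-∧not N (g' v) (_≡ᵇ v')) (degS v vN) ⟩
        kept + countTo N (_≡ᵇ v') + E      ≤⟨ +-monoˡ-≤ E (+-monoʳ-≤ kept atMostV') ⟩
        kept + 1 + E                       ∎
        where
        open ≤-Reasoning
        atMostV' : countTo N (_≡ᵇ v') ≤ 1
        atMostV' = countTo-atMostOne N (_≡ᵇ v') v' (λ k _ e → ≡ᵇ-sound e)
      positive : 0 < kept
      positive = +-cancelʳ-≤ (1 + E) 1 kept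
        (subst₂ _≤_ (+-comm E 2) (+-assoc kept 1 E) (≤-trans E+2≤a bound))
    ... | w , wN , e = w , wN , ∧-conicalˡ _ _ e , w≢v' , w≢v
      where
      w≢v' : ¬ w ≡ v'
      w≢v' refl with trans (sym (cong not (≡ᵇ-refl w))) (∧-conicalʳ _ _ e)
      ... | ()
      w≢v : ¬ w ≡ v
      w≢v refl with trans (sym (adj-irrefl a t v vN)) (∧-conicalˡ _ _ (∧-conicalˡ _ _ e))
      ... | ()

    toHub : ∀ k → k < N → ¬ k ≡ y t → ¬ k ≡ z t → Walk k 0
    toHub k kN ny nz with view t k kN
    ... | vA p = toA0 k p
    ... | vB j p refl = toB0 j p ⁀ reverse cross
    ... | vY e = ⊥-elim (ny e)
    ... | vZ e = ⊥-elim (nz e)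

    hubToA : ∀ v v' → v < N → countTo N (adj a t v) ≡ a →
      (∀ w → ¬ w ≡ v → ¬ w ≡ v' → ¬ w ≡ y t × ¬ w ≡ z t) → Walk v 0
    hubToA v v' vN dv outside = viaNeighbour (otherNeighbour v v' vN dv)
      where
      viaNeighbour : (Σ ℕ λ w → w < N × g' v w ≡ true × ¬ w ≡ v' × ¬ w ≡ v) → Walk v 0
      viaNeighbour (w , wN , e , w≢v' , w≢v) =
        edge vN wN e ⁀ toHub w wN (proj₁ (outside w w≢v w≢v')) (proj₂ (outside w w≢v w≢v'))

    toA : ∀ k → k < N → Walk k 0
    toA k kN with view t k kN
    ... | vA p = toA0 k p
    ... | vB j p refl = toB0 j p ⁀ reverse cross
    ... | vY refl = hubToA (y t) (z t) y<N degY (λ w w≢y w≢z → w≢y , w≢z)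
    ... | vZ refl = hubToA (z t) (y t) z<N degZ (λ w w≢z w≢y → w≢y , w≢z)

    connected : Connected G'
    connected u v = subst₂ (Reach G') (toFin-toℕ d u) (toFin-toℕ d v)
      (toA (toℕ u) (toℕ<n u) ⁀ reverse (toA (toℕ v) (toℕ<n v)))

proposition1 : (a b t : ℕ) → Even a → Even b → 12 ≤ 3 * a → 3 * a ≤ b →
    (a + b) ^ 2 ≤ 2 * b * t + 3 * a + 4 * b →
    KEdgeConnected (H a t) (a ∸ 1) × ¬ KEdgeConnected (H a t) a ×
    KEdgeConnected (H a t) 2 ×
    b * (2 * a + b) + a * a ≤ b * (t + t + 2) + 2 * b + 3 * a ×
    MinDegGE (H a t) a ×
    ((u v : Fin (t + t + 2)) → ¬ u ≡ v → H a t u v ≡ false →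
    2 * a * (t + t + 2) ≤ (a + b) * (deg (H a t) u + deg (H a t) v)) ×
    ¬ HasEvenFactor (H a t) a b
proposition1 a b t (divides m a≡m*2) _ 12≤3a 3a≤b hyp =
  κ'≥a-1 , notAEdgeConnected , κ'≥2 , Arith.orderBound a b t hyp , minDegree , σ₂-bound , noEvenFactor b
  where
  a≡m+m : a ≡ m + m
  a≡m+m = trans a≡m*2 (trans (*-comm m 2) (cong (m +_) (+-identityʳ m)))
  4≤a : 4 ≤ a
  4≤a = *-cancelˡ-≤ 3 12≤3a
  2≤m : 2 ≤ m
  2≤m = *-cancelˡ-≤ 2 (subst (4 ≤_) (trans a≡m*2 (*-comm m 2)) 4≤a)
  2a≤t+3 : a + a ≤ t + 3
  2a≤t+3 = Arith.t-large a b t (≤-trans (s≤s z≤n) 4≤a) (≤-trans (m≤n*m a 3) 3a≤b) hyp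
  a<t : a < t
  a<t = +-cancelʳ-≤ 3 (suc a) t
          (≤-trans (≤-reflexive (sym (+-suc a 3))) (≤-trans (+-monoʳ-≤ a 4≤a) 2a≤t+3))
  open Construction a t m (trans (cong (_/ 2) a≡m*2) (m*n/n≡m m 2)) a≡m+m 2≤m a<t
  κ'≥a-1 : KEdgeConnected (H a t) (a ∸ 1)
  κ'≥a-1 = Deletion.connected 2a≤t+3
  κ'≥2 : KEdgeConnected (H a t) 2
  κ'≥2 S S-sym S⊆H few =
    κ'≥a-1 S S-sym S⊆H (<-≤-trans few (∸-monoˡ-≤ 1 (≤-trans (s≤s (s≤s (s≤s z≤n))) 4≤a)))
  σ₂-bound : (u v : Fin N) → ¬ u ≡ v → H a t u v ≡ false →
    2 * a * (t + t + 2) ≤ (a + b) * (deg (H a t) u + deg (H a t) v)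
  σ₂-bound u v u≢v uv =
    Arith.degreeSumBound a b t _ (≤-trans (s≤s (s≤s z≤n)) 4≤a) 3a≤b (nonAdjacentDegrees u v u≢v uv)
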